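{- (i) For every permutation $(a_1,a_2,a_3,\ldots)$ of the positive integers, there exist indices $i<j<k$ such that $a_i, a_j, a_k$ is an arithmetic progression with odd common difference, i.e. $a_j - a_i = a_k - a_j$ and this common value is odd. (ii) There exists a permutation $(a_1,a_2,a_3,\ldots)$ of the positive integers such that there are no indices $i<j<k<l$ for which $a_i,a_j,a_k,a_l$ is an arithmetic progression with odd common difference.
   Context: A permutation of the positive integers is a sequence $(a_m)_{m\ge 1}$ in which every positive integer appears exactly once. The common difference may be positive or negative; "odd" means it is an odd integer. -}

module Defs where

open import Data.Nat using (ℕ; _≤_; _<_)
open import Data.Integer using (ℤ; +_; _-_; _+_; _*_)
open import Data.Product using (Σ; _×_; ∃)
open import Relation.Binary.PropositionalEquality using (_≡_)

-- A sequence (a_m)_{m ≥ 1} is modelled as a function a : ℕ → ℕ whose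
-- values at indices m ≥ 1 are the terms; the value at index 0 is ignored.
record IsPermPos (a : ℕ → ℕ) : Set where
  field
    positive   : ∀ m → 1 ≤ m → 1 ≤ a m
    injective  : ∀ m n → 1 ≤ m → 1 ≤ n → a m ≡ a n → m ≡ n
    surjective : ∀ v → 1 ≤ v → Σ ℕ (λ m → 1 ≤ m × a m ≡ v)

Odd : ℤ → Set
Odd d = ∃ λ k → d ≡ + 1 + + 2 * k

OddAP3 : ℕ → ℕ → ℕ → Set
OddAP3 x y z = ((+ y - + x) ≡ (+ z - + y)) × Odd (+ y - + x)

OddAP4 : ℕ → ℕ → ℕ → ℕ → Set
OddAP4 x y z w =
  ((+ y - + x) ≡ (+ z - + y)) × ((+ z - + y) ≡ (+ w - + z)) × Odd (+ y - + x)

-- (i) Let j be the position of a 1 + 1 and M = max (a 0, …, a j). A value a n > M sits after j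
-- and differs by an odd d from a 1 or from a j. If a n + d occurs after n, this is the
-- progression; otherwise it occurs at an earlier position, again with a value above M, and
-- positions cannot descend forever.
-- (ii) In 2, 4, 1, 6, 8, 3, 10, 12, 5, … (block m is 4m + 2, 4m + 4, 2m + 1) the even values and
-- the odd values each appear in increasing order, and an odd value v is followed only by even
-- values above 2v. Terms of a progression with odd difference d alternate in parity, so a
-- decreasing one has two equal-parity terms in decreasing order, and an increasing one of
-- length four has an odd term v ≥ d followed by the even term v + d ≤ 2v.

module Submission where

open import Defs
open import Data.Bool using (Bool; true; false; not)
open import Data.Bool.Properties using (not-involutive)
open import Data.Empty using (⊥-elim)
open import Data.Integer as ℤ using (+_; -[1+_]; -_)
open import Data.Integer.Properties as ℤ using (neg-involutive; pos-*)
open import Data.Nat using (ℕ; zero; suc; _+_; _*_; _⊔_; _≤_; _<_; z≤n; s≤s; s≤s⁻¹; z<s)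
open import Data.Nat.Induction using (<-rec)
open import Data.Nat.Properties
open import Data.Product using (Σ; ∃; ∃₂; _×_; _,_)
open import Data.Product.Relation.Binary.Lex.Strict using (×-Lex)
open import Data.Sum using (_⊎_; inj₁; inj₂)
open import Function using (_on_)
open import Relation.Binary using (tri<; tri≈; tri>)
open import Relation.Binary.PropositionalEquality
open import Relation.Nullary using (¬_)
import Data.Integer.Tactic.RingSolver as ℤ-Solver
import Data.Nat.Tactic.RingSolver as ℕ-Solver

i≡j+[i-j] : ∀ i j → i ≡ j ℤ.+ (i ℤ.- j)
i≡j+[i-j] = ℤ-Solver.solve-∀

j≡i-[i-j] : ∀ i j → j ≡ i ℤ.- (i ℤ.- j)
j≡i-[i-j] = ℤ-Solver.solve-∀

[i+j]-i≡j : ∀ i j → (i ℤ.+ j) ℤ.- i ≡ j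
[i+j]-i≡j = ℤ-Solver.solve-∀

1+2*[-[1+j]]≡-[1+2*j] : ∀ j → + 1 ℤ.+ + 2 ℤ.* (- (+ 1 ℤ.+ j)) ≡ - (+ 1 ℤ.+ + 2 ℤ.* j)
1+2*[-[1+j]]≡-[1+2*j] = ℤ-Solver.solve-∀

m-n≡+o⇒m≡n+o : ∀ {m n o} → + m ℤ.- + n ≡ + o → m ≡ n + o
m-n≡+o⇒m≡n+o {m} {n} eq = ℤ.+-injective (trans (i≡j+[i-j] (+ m) (+ n)) (cong (λ δ → + n ℤ.+ δ) eq))

m-n≡-o⇒n≡m+o : ∀ {m n o} → + m ℤ.- + n ≡ - + o → n ≡ m + o
m-n≡-o⇒n≡m+o {m} {n} {o} eq = ℤ.+-injective (begin
  + n                        ≡⟨ j≡i-[i-j] (+ m) (+ n) ⟩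
  + m ℤ.- (+ m ℤ.- + n)      ≡⟨ cong (λ δ → + m ℤ.- δ) eq ⟩
  + m ℤ.+ - - + o            ≡⟨ cong (λ δ → + m ℤ.+ δ) (neg-involutive (+ o)) ⟩
  + (m + o)                  ∎)
  where open ≡-Reasoning

[m+n]-m≡n : ∀ m n → + (m + n) ℤ.- + m ≡ + n
[m+n]-m≡n m n = [i+j]-i≡j (+ m) (+ n)

1+2*t≡1+t*2 : ∀ t → + 1 ℤ.+ + 2 ℤ.* + t ≡ + suc (t * 2)
1+2*t≡1+t*2 t = begin
  + 1 ℤ.+ + 2 ℤ.* + t   ≡⟨ cong (λ δ → + 1 ℤ.+ δ) (pos-* 2 t) ⟨
  + suc (2 * t)          ≡⟨ cong (λ n → + suc n) (*-comm 2 t) ⟩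
  + suc (t * 2)          ∎
  where open ≡-Reasoning

odd-1+t*2 : ∀ t → Odd (+ suc (t * 2))
odd-1+t*2 t = + t , sym (1+2*t≡1+t*2 t)

odd⇒±[1+t*2] : ∀ {δ} → Odd δ → ∃ λ t → δ ≡ + suc (t * 2) ⊎ δ ≡ - + suc (t * 2)
odd⇒±[1+t*2] (+ t , eq) = t , inj₁ (trans eq (1+2*t≡1+t*2 t))
odd⇒±[1+t*2] (-[1+ t ] , eq) = t , inj₂ (begin
  _                              ≡⟨ eq ⟩
  + 1 ℤ.+ + 2 ℤ.* -[1+ t ]       ≡⟨ 1+2*[-[1+j]]≡-[1+2*j] (+ t) ⟩
  - (+ 1 ℤ.+ + 2 ℤ.* + t)        ≡⟨ cong -_ (1+2*t≡1+t*2 t) ⟩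
  - + suc (t * 2)                ∎)
  where open ≡-Reasoning

oddAP3 : ∀ {x y z d} → Odd (+ d) → y ≡ x + d → z ≡ y + d → OddAP3 x y z
oddAP3 {x} {d = d} odd refl refl =
  trans ([m+n]-m≡n x d) (sym ([m+n]-m≡n (x + d) d)) , subst Odd (sym ([m+n]-m≡n x d)) odd

oddAP4⇒steps : ∀ {x y z w} → OddAP4 x y z w → ∃ λ t →
                 (y ≡ x + suc (t * 2) × z ≡ y + suc (t * 2) × w ≡ z + suc (t * 2)) ⊎
                 (x ≡ y + suc (t * 2) × y ≡ z + suc (t * 2) × z ≡ w + suc (t * 2))
oddAP4⇒steps (eq₁ , eq₂ , odd) with odd⇒±[1+t*2] odd
... | t , inj₁ δ = t , inj₁ (m-n≡+o⇒m≡n+o δ , m-n≡+o⇒m≡n+o δ′ , m-n≡+o⇒m≡n+o (trans (sym eq₂) δ′))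
  where δ′ = trans (sym eq₁) δ
... | t , inj₂ δ = t , inj₂ (m-n≡-o⇒n≡m+o δ , m-n≡-o⇒n≡m+o δ′ , m-n≡-o⇒n≡m+o (trans (sym eq₂) δ′))
  where δ′ = trans (sym eq₁) δ

even⊎odd : ∀ n → ∃ λ t → n ≡ t * 2 ⊎ n ≡ suc (t * 2)
even⊎odd zero = 0 , inj₁ refl
even⊎odd (suc n) with even⊎odd n
... | t , inj₁ refl = t , inj₂ refl
... | t , inj₂ refl = suc t , inj₁ refl

isEven : ℕ → Bool
isEven zero    = true
isEven (suc n) = not (isEven n)

isEven-t*2 : ∀ t → isEven (t * 2) ≡ true
isEven-t*2 zero    = refl
isEven-t*2 (suc t) = trans (not-involutive _) (isEven-t*2 t)

isEven-+odd : ∀ m t → isEven (m + suc (t * 2)) ≡ not (isEven m)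
isEven-+odd zero    t = cong not (isEven-t*2 t)
isEven-+odd (suc m) t = cong not (isEven-+odd m t)

isEven-step : ∀ {m n} t → n ≡ m + suc (t * 2) → isEven n ≡ not (isEven m)
isEven-step {m} t refl = isEven-+odd m t

prefixMax : (ℕ → ℕ) → ℕ → ℕ
prefixMax a zero    = a zero
prefixMax a (suc n) = a (suc n) ⊔ prefixMax a n

≤-prefixMax : ∀ a {m n} → m ≤ n → a m ≤ prefixMax a n
≤-prefixMax a {n = zero}  z≤n = ≤-refl
≤-prefixMax a {n = suc n} m≤1+n with m≤n⇒m<n∨m≡n m≤1+n
... | inj₁ m<1+n = ≤-trans (≤-prefixMax a (s≤s⁻¹ m<1+n)) (m≤n⊔m (a (suc n)) (prefixMax a n))
... | inj₂ refl  = m≤m⊔n (a (suc n)) (prefixMax a n)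

odd-gap : ∀ x u → suc x < u → ∃ λ t → u ≡ x + suc (t * 2) ⊎ u ≡ suc x + suc (t * 2)
odd-gap x u 1+x<u with m≤n⇒∃[o]m+o≡n 1+x<u
... | o , refl with even⊎odd o
...   | t , inj₁ refl = t , inj₂ (sym (+-suc (suc x) (t * 2)))
...   | t , inj₂ refl = suc t , inj₁ (sym (trans (+-suc x _) (cong suc (+-suc x _))))

module _ {a : ℕ → ℕ} (perm : IsPermPos a) where
  open IsPermPos perm

  OddAP3Indices : Set
  OddAP3Indices = Σ ℕ λ i → Σ ℕ λ j → Σ ℕ λ k → 1 ≤ i × i < j × j < k × OddAP3 (a i) (a j) (a k)

  oddAP3-or-earlier : ∀ {p n} t → 1 ≤ p → p < n → a n ≡ a p + suc (t * 2) →
                      OddAP3Indices ⊎ ∃ λ m → m < n × a m ≡ a n + suc (t * 2)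
  oddAP3-or-earlier {p} {n} t 1≤p p<n aₙ≡aₚ+d
    with surjective (a n + d) (≤-trans (s≤s z≤n) (m≤n+m d (a n)))
    where d = suc (t * 2)
  ... | k , _ , aₖ≡aₙ+d with <-cmp n k
  ...   | tri< n<k _ _    = inj₁ (p , n , k , 1≤p , p<n , n<k , oddAP3 (odd-1+t*2 t) aₙ≡aₚ+d aₖ≡aₙ+d)
  ...   | tri≈ _ refl _   = ⊥-elim (<-irrefl aₖ≡aₙ+d (m<m+n (a n) z<s))
  ...   | tri> _ _ k<n    = inj₂ (k , k<n , aₖ≡aₙ+d)

  oddAP3-beyond : ∀ {j} → 1 ≤ j → a j ≡ suc (a 1) → ∀ n → prefixMax a j < a n → OddAP3Indices
  oddAP3-beyond {j} 1≤j aⱼ≡1+a₁ = <-rec (λ n → M < a n → OddAP3Indices) step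
    where
    M = prefixMax a j

    after-j : ∀ {n} → M < a n → j < n
    after-j M<aₙ = ≰⇒> (λ n≤j → <⇒≱ M<aₙ (≤-prefixMax a n≤j))

    earlier-odd-gap : ∀ {n} → M < a n → ∃₂ λ t p → 1 ≤ p × p < n × a n ≡ a p + suc (t * 2)
    earlier-odd-gap {n} M<aₙ with odd-gap (a 1) (a n) (≤-<-trans 1+a₁≤M M<aₙ)
      where 1+a₁≤M = subst (_≤ M) aⱼ≡1+a₁ (≤-prefixMax a ≤-refl)
    ... | t , inj₁ aₙ≡a₁+d   = t , 1 , ≤-refl , ≤-<-trans 1≤j (after-j M<aₙ) , aₙ≡a₁+d
    ... | t , inj₂ aₙ≡1+a₁+d =
      t , j , 1≤j , after-j M<aₙ , trans aₙ≡1+a₁+d (cong (_+ suc (t * 2)) (sym aⱼ≡1+a₁))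

    step : ∀ n → (∀ {m} → m < n → M < a m → OddAP3Indices) → M < a n → OddAP3Indices
    step n rec M<aₙ with earlier-odd-gap M<aₙ
    ... | t , p , 1≤p , p<n , aₙ≡aₚ+d with oddAP3-or-earlier t 1≤p p<n aₙ≡aₚ+d
    ...   | inj₁ ap                  = ap
    ...   | inj₂ (m , m<n , aₘ≡aₙ+d) =
      rec m<n (<-≤-trans M<aₙ (subst (a n ≤_) (sym aₘ≡aₙ+d) (m≤m+n (a n) _)))

  oddAP3-exists : OddAP3Indices
  oddAP3-exists with surjective (suc (a 1)) (s≤s z≤n)
  ... | j , 1≤j , aⱼ≡1+a₁ with surjective (suc (prefixMax a j)) (s≤s z≤n)
  ...   | n , _ , aₙ≡1+M = oddAP3-beyond 1≤j aⱼ≡1+a₁ n (≤-reflexive (sym aₙ≡1+M))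

data Slot : Set where
  first second third : Slot

offset : Slot → ℕ
offset first  = 0
offset second = 1
offset third  = 2

entry : ℕ → Slot → ℕ
entry m first  = 2 + m * 4
entry m second = 4 + m * 4
entry m third  = 1 + m * 2

isEvenSlot : Slot → Bool
isEvenSlot first  = true
isEvenSlot second = true
isEvenSlot third  = false

entriesFrom : ℕ → ℕ → ℕ
entriesFrom m 0                   = entry m first
entriesFrom m 1                   = entry m second
entriesFrom m 2                   = entry m third
entriesFrom m (suc (suc (suc q))) = entriesFrom (suc m) q

blockPerm : ℕ → ℕ
blockPerm zero    = 0
blockPerm (suc q) = entriesFrom 0 q

position : ℕ → Slot → ℕ
position m s = suc (m * 3 + offset s)

entriesFrom-skip : ∀ b m q → entriesFrom b (m * 3 + q) ≡ entriesFrom (m + b) q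
entriesFrom-skip b zero    q = refl
entriesFrom-skip b (suc m) q = trans (entriesFrom-skip (suc b) m q) (cong (λ c → entriesFrom c q) (+-suc m b))

entriesFrom-offset : ∀ m s → entriesFrom m (offset s) ≡ entry m s
entriesFrom-offset m first  = refl
entriesFrom-offset m second = refl
entriesFrom-offset m third  = refl

blockPerm-position : ∀ m s → blockPerm (position m s) ≡ entry m s
blockPerm-position m s = begin
  entriesFrom 0 (m * 3 + offset s)  ≡⟨ entriesFrom-skip 0 m (offset s) ⟩
  entriesFrom (m + 0) (offset s)    ≡⟨ cong (λ c → entriesFrom c (offset s)) (+-identityʳ m) ⟩
  entriesFrom m (offset s)          ≡⟨ entriesFrom-offset m s ⟩
  entry m s                         ∎
  where open ≡-Reasoning

block-view : ∀ q → ∃₂ λ m s → q ≡ m * 3 + offset s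
block-view 0 = 0 , first , refl
block-view 1 = 0 , second , refl
block-view 2 = 0 , third , refl
block-view (suc (suc (suc q))) with block-view q
... | m , s , refl = suc m , s , refl

position-view : ∀ {n} → 1 ≤ n → ∃₂ λ m s → n ≡ position m s
position-view {suc q} _ with block-view q
... | m , s , refl = m , s , refl

_≺_ : ℕ × Slot → ℕ × Slot → Set
_≺_ = ×-Lex _≡_ _<_ (_<_ on offset)

m*3+offset<[1+m]*3 : ∀ m s → m * 3 + offset s < suc m * 3
m*3+offset<[1+m]*3 m s =
  subst (m * 3 + offset s <_) (+-comm (m * 3) 3) (+-monoʳ-< (m * 3) (offset<3 s))
  where
  offset<3 : ∀ s → offset s < 3
  offset<3 first  = s≤s z≤n
  offset<3 second = s≤s (s≤s z≤n)
  offset<3 third  = s≤s (s≤s (s≤s z≤n))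

position-<⇒≺ : ∀ {m m′ s s′} → position m s < position m′ s′ → (m , s) ≺ (m′ , s′)
position-<⇒≺ {m} {m′} {s} {s′} p<p′ with <-cmp m m′
... | tri< m<m′ _ _ = inj₁ m<m′
... | tri≈ _ refl _ = inj₂ (refl , +-cancelˡ-< (m * 3) (offset s) (offset s′) (s≤s⁻¹ p<p′))
... | tri> _ _ m′<m = ⊥-elim (<-asym p<p′ (s≤s (<-≤-trans (m*3+offset<[1+m]*3 m′ s′) m′-block≤m-block)))
  where m′-block≤m-block = ≤-trans (*-monoˡ-≤ 3 m′<m) (m≤m+n (m * 3) (offset s))

isEven-m*4 : ∀ m → isEven (m * 4) ≡ true
isEven-m*4 m = subst (λ n → isEven n ≡ true) (*-assoc m 2 2) (isEven-t*2 (m * 2))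

isEven-entry : ∀ m s → isEven (entry m s) ≡ isEvenSlot s
isEven-entry m first  = trans (not-involutive _) (isEven-m*4 m)
isEven-entry m second = trans (not-involutive _) (trans (not-involutive _) (isEven-m*4 m))
isEven-entry m third  = cong not (isEven-t*2 m)

isEvenSlot≡false⇒third : ∀ {s} → isEvenSlot s ≡ false → s ≡ third
isEvenSlot≡false⇒third {third} _ = refl

even-entry-≥ : ∀ m {s} → isEvenSlot s ≡ true → 2 + m * 4 ≤ entry m s
even-entry-≥ m {first}  _ = ≤-refl
even-entry-≥ m {second} _ = m≤n+m (2 + m * 4) 2

even-entry-≤ : ∀ m {s} → isEvenSlot s ≡ true → entry m s ≤ 4 + m * 4
even-entry-≤ m {first}  _ = m≤n+m (2 + m * 4) 2
even-entry-≤ m {second} _ = ≤-refl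

even-entries-< : ∀ {m m′ s s′} → isEvenSlot s ≡ true → isEvenSlot s′ ≡ true → m < m′ →
                 entry m s < entry m′ s′
even-entries-< {m} {m′} {s} {s′} even even′ m<m′ = begin-strict
  entry m s       ≤⟨ even-entry-≤ m even ⟩
  4 + m * 4       <⟨ m<n+m (4 + m * 4) {2} z<s ⟩
  2 + suc m * 4   ≤⟨ +-monoʳ-≤ 2 (*-monoˡ-≤ 4 m<m′) ⟩
  2 + m′ * 4      ≤⟨ even-entry-≥ m′ even′ ⟩
  entry m′ s′     ∎
  where open ≤-Reasoning

entry-≺-mono : ∀ {m m′ s s′} → isEvenSlot s ≡ isEvenSlot s′ → (m , s) ≺ (m′ , s′) →
               entry m s < entry m′ s′
entry-≺-mono {s = first}  {first}  _ (inj₁ m<m′) = even-entries-< {s = first} {first} refl refl m<m′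
entry-≺-mono {s = first}  {second} _ (inj₁ m<m′) = even-entries-< {s = first} {second} refl refl m<m′
entry-≺-mono {s = second} {first}  _ (inj₁ m<m′) = even-entries-< {s = second} {first} refl refl m<m′
entry-≺-mono {s = second} {second} _ (inj₁ m<m′) = even-entries-< {s = second} {second} refl refl m<m′
entry-≺-mono {s = third}  {third}  _ (inj₁ m<m′) = +-monoʳ-< 1 (*-monoˡ-< 2 m<m′)
entry-≺-mono {m} {s = first} {second} _ (inj₂ (refl , _)) = m<n+m (2 + m * 4) {2} z<s
entry-≺-mono {s = first}  {first}  _ (inj₂ (_ , ()))
entry-≺-mono {s = second} {first}  _ (inj₂ (_ , ()))
entry-≺-mono {s = second} {second} _ (inj₂ (_ , s≤s ()))
entry-≺-mono {s = third}  {third}  _ (inj₂ (_ , s≤s (s≤s ())))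
entry-≺-mono {s = first}  {third}  () _
entry-≺-mono {s = second} {third}  () _
entry-≺-mono {s = third}  {first}  () _
entry-≺-mono {s = third}  {second} () _

[1+m*2]+[1+m*2]≡2+m*4 : ∀ m → (1 + m * 2) + (1 + m * 2) ≡ 2 + m * 4
[1+m*2]+[1+m*2]≡2+m*4 = ℕ-Solver.solve-∀

third-≺-even : ∀ {m m′ s′} → isEvenSlot s′ ≡ true → (m , third) ≺ (m′ , s′) →
               entry m third + entry m third < entry m′ s′
third-≺-even {m} {m′} {s′} even′ (inj₁ m<m′) = begin-strict
  entry m third + entry m third  ≡⟨ [1+m*2]+[1+m*2]≡2+m*4 m ⟩
  2 + m * 4                      <⟨ +-monoʳ-< 2 (*-monoˡ-< 4 m<m′) ⟩
  2 + m′ * 4                     ≤⟨ even-entry-≥ m′ even′ ⟩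
  entry m′ s′                    ∎
  where open ≤-Reasoning
third-≺-even {s′ = first}  _ (inj₂ (_ , ()))
third-≺-even {s′ = second} _ (inj₂ (_ , s≤s ()))
third-≺-even {s′ = third}  () _

isEven-blockPerm-position : ∀ m s → isEven (blockPerm (position m s)) ≡ isEvenSlot s
isEven-blockPerm-position m s = trans (cong isEven (blockPerm-position m s)) (isEven-entry m s)

blockPerm-<-of-same-parity : ∀ {i k} → 1 ≤ i → i < k → isEven (blockPerm i) ≡ isEven (blockPerm k) →
                             blockPerm i < blockPerm k
blockPerm-<-of-same-parity 1≤i i<k same with position-view 1≤i | position-view (≤-trans 1≤i (<⇒≤ i<k))
... | m , s , refl | m′ , s′ , refl =
  subst₂ _<_ (sym (blockPerm-position m s)) (sym (blockPerm-position m′ s′))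
    (entry-≺-mono slot-parity (position-<⇒≺ i<k))
  where
  slot-parity = trans (sym (isEven-blockPerm-position m s)) (trans same (isEven-blockPerm-position m′ s′))

blockPerm-odd-then-even : ∀ {j k} → 1 ≤ j → j < k →
                          isEven (blockPerm j) ≡ false → isEven (blockPerm k) ≡ true →
                          blockPerm j + blockPerm j < blockPerm k
blockPerm-odd-then-even 1≤j j<k odd even with position-view 1≤j | position-view (≤-trans 1≤j (<⇒≤ j<k))
... | m , s , refl | m′ , s′ , refl
  with isEvenSlot≡false⇒third (trans (sym (isEven-blockPerm-position m s)) odd)
... | refl =
  subst₂ (λ x y → x + x < y) (sym (blockPerm-position m third)) (sym (blockPerm-position m′ s′))
    (third-≺-even {m} (trans (sym (isEven-blockPerm-position m′ s′)) even) (position-<⇒≺ {m} {m′} {third} j<k))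

entry-surjective : ∀ v → 1 ≤ v → ∃₂ λ m s → entry m s ≡ v
entry-surjective v 1≤v with even⊎odd v
... | t , inj₂ refl = t , third , refl
... | zero , inj₁ refl = ⊥-elim (n≮0 1≤v)
... | suc r , inj₁ refl with even⊎odd r
...   | q , inj₁ refl = q , first , cong (λ n → 2 + n) (sym (*-assoc q 2 2))
...   | q , inj₂ refl = q , second , cong (λ n → 4 + n) (sym (*-assoc q 2 2))

blockPerm-isPermPos : IsPermPos blockPerm
blockPerm-isPermPos = record
  { positive   = positive
  ; injective  = injective
  ; surjective = surjective
  }
  where
  positive : ∀ n → 1 ≤ n → 1 ≤ blockPerm n
  positive n 1≤n with position-view 1≤n
  ... | m , s , refl = subst (1 ≤_) (sym (blockPerm-position m s)) (entry-positive s)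
    where
    entry-positive : ∀ s → 1 ≤ entry m s
    entry-positive first  = s≤s z≤n
    entry-positive second = s≤s z≤n
    entry-positive third  = s≤s z≤n

  injective : ∀ m n → 1 ≤ m → 1 ≤ n → blockPerm m ≡ blockPerm n → m ≡ n
  injective m n 1≤m 1≤n eq with <-cmp m n
  ... | tri< m<n _ _ = ⊥-elim (<-irrefl eq (blockPerm-<-of-same-parity 1≤m m<n (cong isEven eq)))
  ... | tri≈ _ m≡n _ = m≡n
  ... | tri> _ _ n<m = ⊥-elim (<-irrefl (sym eq) (blockPerm-<-of-same-parity 1≤n n<m (cong isEven (sym eq))))

  surjective : ∀ v → 1 ≤ v → Σ ℕ (λ n → 1 ≤ n × blockPerm n ≡ v)
  surjective v 1≤v with entry-surjective v 1≤v
  ... | m , s , eq = position m s , s≤s z≤n , trans (blockPerm-position m s) eq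

blockPerm-no-odd-even-step : ∀ {x q r d} → 1 ≤ q → q < r →
                             blockPerm q ≡ x + d → blockPerm r ≡ blockPerm q + d →
                             isEven (blockPerm q) ≡ false → ¬ isEven (blockPerm r) ≡ true
blockPerm-no-odd-even-step {x} {q} {d = d} 1≤q q<r Aq≡x+d Ar≡Aq+d odd even =
  <⇒≱ (+-cancelˡ-< (blockPerm q) (blockPerm q) d Aq+Aq<Aq+d) (subst (d ≤_) (sym Aq≡x+d) (m≤n+m d x))
  where
  Aq+Aq<Aq+d = subst (blockPerm q + blockPerm q <_) Ar≡Aq+d (blockPerm-odd-then-even 1≤q q<r odd even)

blockPerm-no-OddAP4 : ∀ i j k l → 1 ≤ i → i < j → j < k → k < l →
                      ¬ OddAP4 (blockPerm i) (blockPerm j) (blockPerm k) (blockPerm l)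
blockPerm-no-OddAP4 i j k l 1≤i i<j j<k k<l ap with oddAP4⇒steps ap
... | t , inj₁ (Aⱼ≡Aᵢ+d , Aₖ≡Aⱼ+d , Aₗ≡Aₖ+d) with isEven (blockPerm j) in parityⱼ
...   | false = blockPerm-no-odd-even-step 1≤j j<k Aⱼ≡Aᵢ+d Aₖ≡Aⱼ+d parityⱼ
                  (trans (isEven-step t Aₖ≡Aⱼ+d) (cong not parityⱼ))
  where 1≤j = ≤-trans 1≤i (<⇒≤ i<j)
...   | true  = blockPerm-no-odd-even-step 1≤k k<l Aₖ≡Aⱼ+d Aₗ≡Aₖ+d parityₖ
                  (trans (isEven-step t Aₗ≡Aₖ+d) (cong not parityₖ))
  where
  1≤k = ≤-trans 1≤i (<⇒≤ (<-trans i<j j<k))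
  parityₖ = trans (isEven-step t Aₖ≡Aⱼ+d) (cong not parityⱼ)
blockPerm-no-OddAP4 i j k l 1≤i i<j j<k k<l ap
  | t , inj₂ (Aᵢ≡Aⱼ+d , Aⱼ≡Aₖ+d , _) =
  <⇒≱ (blockPerm-<-of-same-parity 1≤i (<-trans i<j j<k) same-parity) Aₖ≤Aᵢ
  where
  A = blockPerm
  d = suc (t * 2)
  same-parity : isEven (A i) ≡ isEven (A k)
  same-parity = trans (isEven-step t Aᵢ≡Aⱼ+d) (trans (cong not (isEven-step t Aⱼ≡Aₖ+d)) (not-involutive _))
  Aₖ≤Aᵢ : A k ≤ A i
  Aₖ≤Aᵢ = begin
    A k      ≤⟨ m≤m+n (A k) d ⟩
    A k + d  ≡⟨ Aⱼ≡Aₖ+d ⟨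
    A j      ≤⟨ m≤m+n (A j) d ⟩
    A j + d  ≡⟨ Aᵢ≡Aⱼ+d ⟨
    A i      ∎
    where open ≤-Reasoning

theorem2 :
    ((a : ℕ → ℕ) → IsPermPos a →
      Σ ℕ (λ i → Σ ℕ (λ j → Σ ℕ (λ k →
        1 ≤ i × i < j × j < k × OddAP3 (a i) (a j) (a k)))))
    × Σ (ℕ → ℕ) (λ a → IsPermPos a ×
        ((i j k l : ℕ) → 1 ≤ i → i < j → j < k → k < l →
          ¬ OddAP4 (a i) (a j) (a k) (a l)))
theorem2 = (λ _ → oddAP3-exists) , (blockPerm , blockPerm-isPermPos , blockPerm-no-OddAP4)
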